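{- Let $\mathbb G=(G;\rightarrow)$ be a digraph, let $\Omega\leq\mathrm{Aut}(\mathbb G)$ be oligomorphic, and let $O$ be an orbit of $\Omega$ on $G$. Then there exists a symmetric $\Omega$-orbit-labelled path $\pi$ starting at $O$ such that $\gamma_\pi\supseteq\gamma_\rho$ for every symmetric $\Omega$-orbit-labelled path $\rho$ starting at $O$.
   Context: $\Omega$ is oligomorphic if it has finitely many orbits on $G^k$ for each $k$. A path is a finite sequence $p=(E_1,\dots,E_n)$ with each $E_i\in\{\rightarrow,\leftarrow\}$ (where $\leftarrow$ is the inverse relation). An $\Omega$-orbit-labelled path is a pair $\pi=(p,(P_1,\dots,P_{n+1}))$ with each $P_i$ an orbit of $\Omega$ on $G$; it starts at $P_1$. A realisation of $\pi$ is $(a_1,\dots,a_{n+1})$ with $a_i\in P_i$ and $E_i(a_i,a_{i+1})$ for all $i$. $\gamma_\pi$ is the set of pairs $(a,b)$ such that some realisation starts at $a$ and ends at $b$. $-\pi:=((E_n^{ -1},\dots,E_1^{ -1}),(P_{n+1},\dots,P_1))$; if the last label of $\kappa$ equals the first label of $\lambda$, $\kappa+\lambda$ is their concatenation (sharing that label); $\kappa-\lambda:=\kappa+(-\lambda)$. $\pi$ is symmetric if $\pi=\kappa-\kappa$ for some $\Omega$-orbit-labelled path $\kappa$. -}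

module Defs where

open import Level using (0ℓ)
open import Data.Nat using (ℕ)
open import Data.Unit using (⊤)
open import Data.Fin using (Fin)
open import Data.List using (List; []; _∷_; _++_)
open import Data.Product using (Σ; Σ-syntax; _×_; _,_)
open import Function using (_∘_; id; _↔_; Inverse)
open import Relation.Binary.PropositionalEquality using (_≡_)

record Digraph : Set₁ where
  field
    Carrier : Set
    _⟶_     : Carrier → Carrier → Set

module _ (𝔾 : Digraph) where
  open Digraph 𝔾 renaming (Carrier to G)

  record Aut : Set where
    field
      perm   : G ↔ G
      pres   : ∀ {x y} → x ⟶ y → Inverse.to perm x ⟶ Inverse.to perm y
      refl⟶ : ∀ {x y} → Inverse.to perm x ⟶ Inverse.to perm y → x ⟶ y

  app : Aut → G → G
  app g = Inverse.to (Aut.perm g)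

  app⁻¹ : Aut → G → G
  app⁻¹ g = Inverse.from (Aut.perm g)

  -- Ω ≤ Aut(𝔾), with Ω given as a set (predicate) of automorphisms,
  -- closed under identity, composition and inverses (automorphisms
  -- compared by their action on G).
  record IsAutSubgroup (Ω : Aut → Set) : Set where
    field
      has-id  : Σ[ e ∈ Aut ] (Ω e × (∀ x → app e x ≡ x))
      has-∘   : ∀ g h → Ω g → Ω h →
                Σ[ k ∈ Aut ] (Ω k × (∀ x → app k x ≡ app h (app g x)))
      has-inv : ∀ g → Ω g → Σ[ k ∈ Aut ] (Ω k × (∀ x → app k x ≡ app⁻¹ g x))

  module _ (Ω : Aut → Set) where

    SameOrbitᵏ : {k : ℕ} → (Fin k → G) → (Fin k → G) → Set
    SameOrbitᵏ x y = Σ[ g ∈ Aut ] (Ω g × (∀ i → app g (x i) ≡ y i))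

    Oligomorphic : Set
    Oligomorphic = ∀ (k : ℕ) → Σ[ n ∈ ℕ ] Σ[ reps ∈ (Fin n → Fin k → G) ]
                     (∀ (x : Fin k → G) → Σ[ i ∈ Fin n ] SameOrbitᵏ (reps i) x)

    _∼_ : G → G → Set
    a ∼ x = Σ[ g ∈ Aut ] (Ω g × app g a ≡ x)

    IsOrbit : (G → Set) → Set
    IsOrbit P = Σ[ a ∈ G ] (∀ x → (P x → a ∼ x) × (a ∼ x → P x))

  Label : Set₁
  Label = G → Set

  data Dir : Set where
    fwd bwd : Dir

  flipDir : Dir → Dir
  flipDir fwd = bwd
  flipDir bwd = fwd

  Step : Dir → G → G → Set
  Step fwd x y = x ⟶ y
  Step bwd x y = y ⟶ x

  -- A labelled path ((E₁,…,Eₙ),(P₁,…,Pₙ₊₁)) is stored as P₁ together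
  -- with the list [(E₁,P₂),…,(Eₙ,Pₙ₊₁)].
  record LPath : Set₁ where
    constructor lpath
    field
      start : Label
      steps : List (Dir × Label)
  open LPath public

  AllLabels : (Label → Set) → LPath → Set
  AllLabels Q (lpath P ss) = Q P × go ss
    where
    go : List (Dir × Label) → Set
    go [] = ⊤
    go ((_ , L) ∷ ss') = Q L × go ss'

  OrbitLabelled : (Aut → Set) → LPath → Set
  OrbitLabelled Ω = AllLabels (IsOrbit Ω)

  snoc : LPath → Dir × Label → LPath
  snoc (lpath P ss) s = lpath P (ss ++ (s ∷ []))

  neg′ : Label → List (Dir × Label) → LPath
  neg′ P [] = lpath P []
  neg′ P ((E , Q) ∷ ss) = snoc (neg′ Q ss) (flipDir E , P)

  neg : LPath → LPath
  neg (lpath P ss) = neg′ P ss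

  -- κ + λ (meaningful when the last label of κ is the first label of λ;
  -- the shared label is λ's first label, i.e. κ's last one)
  _⊕_ : LPath → LPath → LPath
  lpath P ss ⊕ lpath _ ts = lpath P (ss ++ ts)

  _⊖_ : LPath → LPath → LPath
  κ ⊖ λ′ = κ ⊕ neg λ′

  -- π is symmetric: π = κ − κ for some Ω-orbit-labelled κ
  -- (κ − κ is always defined: last κ = first (−κ)).
  Symmetric : (Aut → Set) → LPath → Set₁
  Symmetric Ω π = Σ[ κ ∈ LPath ] (OrbitLabelled Ω κ × π ≡ κ ⊖ κ)

  Realises : Label → List (Dir × Label) → G → G → Set
  Realises P [] a b = P a × a ≡ b
  Realises P ((E , Q) ∷ ss) a b = P a × Σ[ c ∈ G ] (Step E a c × Realises Q ss c b)

  γ : LPath → G → G → Set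
  γ (lpath P ss) a b = Realises P ss a b

{-# OPTIONS --safe #-}
-- The pairs realised by a symmetric path κ − κ are those that κ joins to a common
-- endpoint. This relation is Ω-invariant, and as Ω is transitive on O, once κ − κ
-- is realised from one point of O it has a loop at every point of O. Ω has finitely
-- many orbits on pairs; for each one whose representative is realised by a symmetric
-- path from O, excluded middle picks such a path κᵢ − κᵢ. Their concatenation K has
-- a loop at every point of O, so γ_K, and hence γ_{K − K}, contains each γ_{κᵢ − κᵢ}
-- on O × O. Moving an arbitrary realised pair to its orbit representative by Ω then
-- shows that π = K − K dominates every symmetric path from O.
module Submission where

open import Defs
open import Level using (0ℓ)
open import Axiom.ExcludedMiddle using (ExcludedMiddle)
open import Data.Empty using (⊥-elim)
open import Data.Fin using (Fin; zero; suc)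
open import Data.Nat using (zero; suc)
open import Data.List using (List; []; _∷_; _++_; map; concatMap)
open import Data.List.Membership.Propositional using (_∈_)
open import Data.List.Membership.Propositional.Properties using (∈-map⁺)
open import Data.List.Relation.Unary.All as All using (All; []; _∷_)
open import Data.List.Relation.Unary.All.Properties using (map⁺)
open import Data.List.Relation.Unary.Any using (here; there)
open import Data.Product using (Σ-syntax; ∃; ∃-syntax; _×_; _,_; proj₁; proj₂; map₂)
open import Data.Unit using (tt)
open import Function using (_∘_; id; Inverse)
open import Relation.Binary.Core using (_⇒_)
open import Relation.Binary.PropositionalEquality
  using (_≡_; refl; sym; trans; cong; subst; subst₂)
open import Relation.Nullary using (Dec; yes; no)

chooseWitnesses : ∀ {n} {A : Set} (R : Fin n → A → Set) → (∀ i → Dec (∃ (R i))) →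
                  Σ[ xs ∈ List A ] (All (λ x → ∃[ i ] R i x) xs ×
                                    (∀ i → ∃ (R i) → ∃[ x ] (x ∈ xs × R i x)))
chooseWitnesses {zero} R R? = [] , [] , λ ()
chooseWitnesses {suc n} R R? with chooseWitnesses (R ∘ suc) (R? ∘ suc) | R? zero
... | xs , xs-ok , covers | yes (x , r) =
  x ∷ xs , (zero , r) ∷ All.map (λ (i , r) → suc i , r) xs-ok , covers′
  where
  covers′ : ∀ i → ∃ (R i) → ∃[ y ] (y ∈ x ∷ xs × R i y)
  covers′ zero _ = x , here refl , r
  covers′ (suc i) h = let y , y∈xs , ry = covers i h in y , there y∈xs , ry
... | xs , xs-ok , covers | no ¬r =
  xs , All.map (λ (i , r) → suc i , r) xs-ok , λ where
    zero h → ⊥-elim (¬r h)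
    (suc i) h → covers i h

module _ (𝔾 : Digraph) where
  open Digraph 𝔾 renaming (Carrier to G)

  lastLabel : Label 𝔾 → List (Dir 𝔾 × Label 𝔾) → Label 𝔾
  lastLabel P [] = P
  lastLabel P ((_ , Q) ∷ ss) = lastLabel Q ss

  Realises-start : ∀ {P} ss {a b} → Realises 𝔾 P ss a b → P a
  Realises-start [] (p , _) = p
  Realises-start (_ ∷ _) (p , _) = p

  Realises-restart : ∀ {P Q} ss {a b} → Q a → Realises 𝔾 P ss a b → Realises 𝔾 Q ss a b
  Realises-restart [] q (_ , a≡b) = q , a≡b
  Realises-restart (_ ∷ _) q (_ , r) = q , r

  Realises-++⁺ : ∀ {P Q} ss {ts a c b} →
                 Realises 𝔾 P ss a c → Realises 𝔾 Q ts c b → Realises 𝔾 P (ss ++ ts) a b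
  Realises-++⁺ [] {ts} (p , refl) r = Realises-restart ts p r
  Realises-++⁺ (_ ∷ ss) (p , d , s , r) r′ = p , d , s , Realises-++⁺ ss r r′

  Realises-++⁻ : ∀ P ss {ts a b} → Realises 𝔾 P (ss ++ ts) a b →
                 ∃[ c ] (Realises 𝔾 P ss a c × Realises 𝔾 (lastLabel P ss) ts c b)
  Realises-++⁻ P [] {ts} r = _ , (Realises-start ts r , refl) , r
  Realises-++⁻ P ((_ , Q) ∷ ss) (p , d , s , r) =
    let c , r₁ , r₂ = Realises-++⁻ Q ss r in c , (p , d , s , r₁) , r₂

  Step-flipDir⁺ : ∀ E {a c} → Step 𝔾 E a c → Step 𝔾 (flipDir 𝔾 E) c a
  Step-flipDir⁺ fwd s = s
  Step-flipDir⁺ bwd s = s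

  Step-flipDir⁻ : ∀ E {a c} → Step 𝔾 (flipDir 𝔾 E) c a → Step 𝔾 E a c
  Step-flipDir⁻ fwd s = s
  Step-flipDir⁻ bwd s = s

  start-neg′ : ∀ P ss → start (neg′ 𝔾 P ss) ≡ lastLabel P ss
  start-neg′ P [] = refl
  start-neg′ P ((_ , Q) ∷ ss) = start-neg′ Q ss

  Realises-neg′⁺ : ∀ P ss {a b} → Realises 𝔾 P ss a b → γ 𝔾 (neg′ 𝔾 P ss) b a
  Realises-neg′⁺ P [] (p , refl) = p , refl
  Realises-neg′⁺ P ((E , Q) ∷ ss) {a} (p , c , s , r) =
    Realises-++⁺ {Q = Q} (steps (neg′ 𝔾 Q ss)) {ts = (flipDir 𝔾 E , P) ∷ []}
                 (Realises-neg′⁺ Q ss r)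
                 (Realises-start ss r , a , Step-flipDir⁺ E s , p , refl)

  Realises-neg′⁻ : ∀ P ss {a b} → γ 𝔾 (neg′ 𝔾 P ss) b a → Realises 𝔾 P ss a b
  Realises-neg′⁻ P [] (p , refl) = p , refl
  Realises-neg′⁻ P ((E , Q) ∷ ss) r with Realises-++⁻ _ (steps (neg′ 𝔾 Q ss)) r
  ... | c , r₁ , (_ , _ , s , p , refl) = p , c , Step-flipDir⁻ E s , Realises-neg′⁻ Q ss r₁

  γ-⊖-self⁺ : ∀ κ {a b c} → γ 𝔾 κ a c → γ 𝔾 κ b c → γ 𝔾 (_⊖_ 𝔾 κ κ) a b
  γ-⊖-self⁺ (lpath P ss) ra rb = Realises-++⁺ ss ra (Realises-neg′⁺ P ss rb)

  γ-⊖-self⁻ : ∀ κ {a b} → γ 𝔾 (_⊖_ 𝔾 κ κ) a b → ∃[ c ] (γ 𝔾 κ a c × γ 𝔾 κ b c)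
  γ-⊖-self⁻ (lpath P ss) {b = b} r =
    let c , ra , rb = Realises-++⁻ P ss r
        rb′ = subst (λ L → Realises 𝔾 L (steps (neg′ 𝔾 P ss)) c b) (sym (start-neg′ P ss)) rb
    in c , ra , Realises-neg′⁻ P ss rb′

  γ-⊖-self-mono : ∀ κ λ′ → γ 𝔾 κ ⇒ γ 𝔾 λ′ → γ 𝔾 (_⊖_ 𝔾 κ κ) ⇒ γ 𝔾 (_⊖_ 𝔾 λ′ λ′)
  γ-⊖-self-mono κ λ′ κ⇒λ r =
    let _ , ra , rb = γ-⊖-self⁻ κ r in γ-⊖-self⁺ λ′ (κ⇒λ ra) (κ⇒λ rb)

  γ-⊖-self-starts : ∀ κ {a b} → γ 𝔾 (_⊖_ 𝔾 κ κ) a b → start κ a × start κ b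
  γ-⊖-self-starts κ r =
    let _ , ra , rb = γ-⊖-self⁻ κ r in Realises-start (steps κ) ra , Realises-start (steps κ) rb

  AllLabels-map : ∀ {Q Q′ : Label 𝔾 → Set} → (∀ {L} → Q L → Q′ L) →
                  ∀ P ss → AllLabels 𝔾 Q (lpath P ss) → AllLabels 𝔾 Q′ (lpath P ss)
  AllLabels-map f P [] (q , tt) = f q , tt
  AllLabels-map f P ((_ , L) ∷ ss) (q , qs) = f q , AllLabels-map f L ss qs

  AllLabels-⊕ : ∀ {Q} P ss λ′ → AllLabels 𝔾 Q (lpath P ss) → AllLabels 𝔾 Q λ′ →
                AllLabels 𝔾 Q (_⊕_ 𝔾 (lpath P ss) λ′)
  AllLabels-⊕ P [] _ (q , tt) (_ , qs) = q , qs
  AllLabels-⊕ P ((_ , L) ∷ ss) λ′ (q , qs) qs′ = q , AllLabels-⊕ L ss λ′ qs qs′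

  AllLabels-neg′ : ∀ {Q} P ss → AllLabels 𝔾 Q (lpath P ss) → AllLabels 𝔾 Q (neg′ 𝔾 P ss)
  AllLabels-neg′ P [] qs = qs
  AllLabels-neg′ P ((E , L) ∷ ss) (q , qs) =
    AllLabels-⊕ _ (steps (neg′ 𝔾 L ss)) (lpath P ((flipDir 𝔾 E , P) ∷ []))
                (AllLabels-neg′ L ss qs) (q , q , tt)

  AllLabels-⊖ : ∀ {Q} κ λ′ → AllLabels 𝔾 Q κ → AllLabels 𝔾 Q λ′ → AllLabels 𝔾 Q (_⊖_ 𝔾 κ λ′)
  AllLabels-⊖ κ λ′ qκ qλ =
    AllLabels-⊕ (start κ) (steps κ) (neg 𝔾 λ′) qκ (AllLabels-neg′ (start λ′) (steps λ′) qλ)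

  Preserves : Aut 𝔾 → Label 𝔾 → Set
  Preserves g L = ∀ {x} → L x → L (app 𝔾 g x)

  Step-app : ∀ (g : Aut 𝔾) E {a c} → Step 𝔾 E a c → Step 𝔾 E (app 𝔾 g a) (app 𝔾 g c)
  Step-app g fwd s = Aut.pres g s
  Step-app g bwd s = Aut.pres g s

  Realises-app : ∀ (g : Aut 𝔾) P ss → AllLabels 𝔾 (Preserves g) (lpath P ss) →
                 ∀ {a b} → Realises 𝔾 P ss a b → Realises 𝔾 P ss (app 𝔾 g a) (app 𝔾 g b)
  Realises-app g P [] (gP , tt) (p , refl) = gP p , refl
  Realises-app g P ((E , L) ∷ ss) (gP , gs) (p , c , s , r) =
    gP p , app 𝔾 g c , Step-app g E s , Realises-app g L ss gs r

  module _ (Ω : Aut 𝔾 → Set) (Ω≤Aut : IsAutSubgroup 𝔾 Ω) where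
    open IsAutSubgroup Ω≤Aut

    Ω-inverse : ∀ {g} → Ω g → Σ[ k ∈ Aut 𝔾 ] (Ω k × ∀ {x y} → app 𝔾 g x ≡ y → app 𝔾 k y ≡ x)
    Ω-inverse {g} Ωg =
      let k , Ωk , k≗g⁻¹ = has-inv g Ωg
      in k , Ωk , λ {x} gx≡y → trans (k≗g⁻¹ _)
                                  (trans (cong (app⁻¹ 𝔾 g) (sym gx≡y))
                                         (Inverse.strictlyInverseʳ (Aut.perm g) x))

    orbit-closed : ∀ {P} → IsOrbit 𝔾 Ω P → ∀ {g} → Ω g → Preserves g P
    orbit-closed (r , P⇔r∼) {g} Ωg {x} px =
      let h , Ωh , hr≡x = proj₁ (P⇔r∼ x) px
          k , Ωk , k≗g∘h = has-∘ h g Ωh Ωg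
      in proj₂ (P⇔r∼ _) (k , Ωk , trans (k≗g∘h r) (cong (app 𝔾 g) hr≡x))

    orbit-transitive : ∀ {P} → IsOrbit 𝔾 Ω P → ∀ {a x} → P a → P x →
                       Σ[ g ∈ Aut 𝔾 ] (Ω g × app 𝔾 g a ≡ x)
    orbit-transitive (r , P⇔r∼) {a} {x} pa px =
      let h₁ , Ωh₁ , h₁r≡a = proj₁ (P⇔r∼ a) pa
          h₂ , Ωh₂ , h₂r≡x = proj₁ (P⇔r∼ x) px
          k , Ωk , k-undoes-h₁ = Ω-inverse Ωh₁
          g , Ωg , g≗h₂∘k = has-∘ k h₂ Ωk Ωh₂
      in g , Ωg , trans (g≗h₂∘k a) (trans (cong (app 𝔾 h₂) (k-undoes-h₁ h₁r≡a)) h₂r≡x)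

    Invariant : (G → G → Set) → Set
    Invariant R = ∀ {g a b} → Ω g → R a b → R (app 𝔾 g a) (app 𝔾 g b)

    γ-invariant : ∀ κ → OrbitLabelled 𝔾 Ω κ → Invariant (γ 𝔾 κ)
    γ-invariant κ oκ {g} Ωg =
      Realises-app g (start κ) (steps κ)
        (AllLabels-map {Q′ = Preserves g} (λ oL → orbit-closed oL Ωg) (start κ) (steps κ) oκ)

    ⇒-from-representatives : ∀ {n} (reps : Fin n → Fin 2 → G) →
                             (∀ x → Σ[ i ∈ Fin n ] SameOrbitᵏ 𝔾 Ω (reps i) x) →
                             ∀ {R S} → Invariant R → Invariant S →
                             (∀ i → R (reps i zero) (reps i (suc zero)) →
                                    S (reps i zero) (reps i (suc zero))) →
                             R ⇒ S
    ⇒-from-representatives reps covers {R} {S} R-inv S-inv R⇒S-on-reps {a} {b} Rab =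
      let i , g , Ωg , g·rep≡ = covers λ { zero → a ; (suc _) → b }
          k , Ωk , k-undoes-g = Ω-inverse Ωg
          R-rep = subst₂ R (k-undoes-g (g·rep≡ zero)) (k-undoes-g (g·rep≡ (suc zero)))
                           (R-inv Ωk Rab)
      in subst₂ S (g·rep≡ zero) (g·rep≡ (suc zero)) (S-inv Ωg (R⇒S-on-reps i R-rep))

    orbitOf : G → Label 𝔾
    orbitOf = _∼_ 𝔾 Ω

    orbitOf-isOrbit : ∀ r → IsOrbit 𝔾 Ω (orbitOf r)
    orbitOf-isOrbit r = r , λ _ → id , id

    -- A code names every label after the first by a representative of its orbit.
    -- Unlike LPath, codes form a Set, so excluded middle at level 0 can decide
    -- whether some orbit-labelled path realises a given pair.
    Code : Set
    Code = List (Dir 𝔾 × G)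

    codePath : Label 𝔾 → Code → LPath 𝔾
    codePath P cs = lpath P (map (map₂ orbitOf) cs)

    codePath-orbitLabelled : ∀ {P} → IsOrbit 𝔾 Ω P → ∀ cs → OrbitLabelled 𝔾 Ω (codePath P cs)
    codePath-orbitLabelled oP [] = oP , tt
    codePath-orbitLabelled oP ((_ , r) ∷ cs) = oP , codePath-orbitLabelled (orbitOf-isOrbit r) cs

    code : ∀ P ss → OrbitLabelled 𝔾 Ω (lpath P ss) →
           Σ[ cs ∈ Code ] (Realises 𝔾 P ss ⇒ γ 𝔾 (codePath P cs))
    code P [] _ = [] , id
    code P ((E , L) ∷ ss) (_ , oL@(r , L⇔r∼) , os) =
      let cs , L⇒cs = code L ss (oL , os)
      in (E , r) ∷ cs ,
         λ (p , c , s , rc) →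
           p , c , s , Realises-restart _ (proj₁ (L⇔r∼ c) (Realises-start ss rc)) (L⇒cs rc)

    module _ {O : Label 𝔾} (oO : IsOrbit 𝔾 Ω O) where

      Loops : LPath 𝔾 → Set
      Loops κ = ∀ {x} → O x → γ 𝔾 κ x x

      ⊖-self-loops : ∀ κ → OrbitLabelled 𝔾 Ω κ → ∀ {a c} → O a → γ 𝔾 κ a c →
                     Loops (_⊖_ 𝔾 κ κ)
      ⊖-self-loops κ oκ {c = c} Oa r Ox =
        let g , Ωg , ga≡x = orbit-transitive oO Oa Ox
            r′ = subst (λ y → γ 𝔾 κ y (app 𝔾 g c)) ga≡x (γ-invariant κ oκ Ωg r)
        in γ-⊖-self⁺ κ r′ r′

      concatPaths : List (LPath 𝔾) → LPath 𝔾
      concatPaths κs = lpath O (concatMap steps κs)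

      concatPaths-orbitLabelled : ∀ {κs} → All (OrbitLabelled 𝔾 Ω) κs →
                                  OrbitLabelled 𝔾 Ω (concatPaths κs)
      concatPaths-orbitLabelled [] = oO , tt
      concatPaths-orbitLabelled {κ ∷ _} ((_ , oκ) ∷ oκs) =
        AllLabels-⊕ O (steps κ) _ (oO , oκ) (concatPaths-orbitLabelled oκs)

      concatPaths-loops : ∀ {κs} → All Loops κs → Loops (concatPaths κs)
      concatPaths-loops [] Ox = Ox , refl
      concatPaths-loops {κ ∷ _} (l ∷ ls) Ox =
        Realises-++⁺ (steps κ) (Realises-restart (steps κ) Ox (l Ox)) (concatPaths-loops ls Ox)

      concatPaths-∈ : ∀ {κs κ a b} → All Loops κs → κ ∈ κs → O a → O b →
                      γ 𝔾 κ a b → γ 𝔾 (concatPaths κs) a b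
      concatPaths-∈ {κ ∷ _} (_ ∷ ls) (here refl) Oa Ob r =
        Realises-++⁺ (steps κ) (Realises-restart (steps κ) Oa r) (concatPaths-loops ls Ob)
      concatPaths-∈ {κ ∷ _} (l ∷ ls) (there κ∈) Oa Ob r =
        Realises-++⁺ (steps κ) (Realises-restart (steps κ) Oa (l Oa))
                     (concatPaths-∈ ls κ∈ Oa Ob r)

      module DominatingPath (em : ExcludedMiddle 0ℓ) {n} (reps : Fin n → Fin 2 → G)
               (covers : ∀ x → Σ[ i ∈ Fin n ] SameOrbitᵏ 𝔾 Ω (reps i) x) where

        symmetricPath : Code → LPath 𝔾
        symmetricPath cs = _⊖_ 𝔾 (codePath O cs) (codePath O cs)

        symmetricPath-orbitLabelled : ∀ cs → OrbitLabelled 𝔾 Ω (symmetricPath cs)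
        symmetricPath-orbitLabelled cs =
          let oκ = codePath-orbitLabelled oO cs in AllLabels-⊖ (codePath O cs) _ oκ oκ

        RealisesRepresentative : Fin n → Code → Set
        RealisesRepresentative i cs = γ 𝔾 (symmetricPath cs) (reps i zero) (reps i (suc zero))

        symmetricPath-loops : ∀ cs → ∃[ i ] RealisesRepresentative i cs → Loops (symmetricPath cs)
        symmetricPath-loops cs (_ , r) =
          let _ , ra , _ = γ-⊖-self⁻ (codePath O cs) r
          in ⊖-self-loops (codePath O cs) (codePath-orbitLabelled oO cs) (Realises-start _ ra) ra

        chosen : List Code
        chosen = proj₁ (chooseWitnesses RealisesRepresentative (λ _ → em))

        chosen-realised : All (λ cs → ∃[ i ] RealisesRepresentative i cs) chosen
        chosen-realised = proj₁ (proj₂ (chooseWitnesses RealisesRepresentative (λ _ → em)))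

        chosen-covers : ∀ i → ∃ (RealisesRepresentative i) →
                        ∃[ cs ] (cs ∈ chosen × RealisesRepresentative i cs)
        chosen-covers = proj₂ (proj₂ (chooseWitnesses RealisesRepresentative (λ _ → em)))

        K : LPath 𝔾
        K = concatPaths (map symmetricPath chosen)

        K-orbitLabelled : OrbitLabelled 𝔾 Ω K
        K-orbitLabelled =
          concatPaths-orbitLabelled {map symmetricPath chosen}
            (map⁺ (All.tabulate λ {cs} _ → symmetricPath-orbitLabelled cs))

        K-loops : All Loops (map symmetricPath chosen)
        K-loops = map⁺ (All.map (λ {cs} → symmetricPath-loops cs) chosen-realised)

        π : LPath 𝔾
        π = _⊖_ 𝔾 K K

        π-orbitLabelled : OrbitLabelled 𝔾 Ω π
        π-orbitLabelled = AllLabels-⊖ K K K-orbitLabelled K-orbitLabelled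

        chosen-⇒-π : ∀ {cs} → cs ∈ chosen → γ 𝔾 (symmetricPath cs) ⇒ γ 𝔾 π
        chosen-⇒-π {cs} cs∈ r =
          let Oa , Ob = γ-⊖-self-starts (codePath O cs) r
              K-ab = concatPaths-∈ {map symmetricPath chosen} K-loops
                                   (∈-map⁺ symmetricPath cs∈) Oa Ob r
          in γ-⊖-self⁺ K K-ab (concatPaths-loops {map symmetricPath chosen} K-loops Ob)

        π-dominates : ∀ κ → OrbitLabelled 𝔾 Ω κ → start κ ≡ O → γ 𝔾 (_⊖_ 𝔾 κ κ) ⇒ γ 𝔾 π
        π-dominates κ oκ refl =
          ⇒-from-representatives reps covers {γ 𝔾 (_⊖_ 𝔾 κ κ)} {γ 𝔾 π}
            (γ-invariant (_⊖_ 𝔾 κ κ) (AllLabels-⊖ κ κ oκ oκ)) (γ-invariant π π-orbitLabelled)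
            λ i r → let cs , κ⇒cs = code (start κ) (steps κ) oκ
                        cs′ , cs′∈ , r′ =
                          chosen-covers i (cs , γ-⊖-self-mono κ (codePath O cs) κ⇒cs r)
                    in chosen-⇒-π {cs′} cs′∈ r′

lemma1 : ExcludedMiddle 0ℓ →
         (𝔾 : Digraph) → (Ω : Aut 𝔾 → Set) → IsAutSubgroup 𝔾 Ω →
         Oligomorphic 𝔾 Ω →
         (O : Label 𝔾) → IsOrbit 𝔾 Ω O →
         Σ[ π ∈ LPath 𝔾 ]
           (OrbitLabelled 𝔾 Ω π × Symmetric 𝔾 Ω π × start π ≡ O ×
            (∀ (ρ : LPath 𝔾) → OrbitLabelled 𝔾 Ω ρ → Symmetric 𝔾 Ω ρ →
               start ρ ≡ O →
               ∀ a b → γ 𝔾 ρ a b → γ 𝔾 π a b))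
lemma1 em 𝔾 Ω Ω≤Aut olig O oO =
  π , π-orbitLabelled , (K , K-orbitLabelled , refl) , refl , dominates
  where
  open DominatingPath 𝔾 Ω Ω≤Aut oO em (proj₁ (proj₂ (olig 2))) (proj₂ (proj₂ (olig 2)))
  dominates : ∀ ρ → OrbitLabelled 𝔾 Ω ρ → Symmetric 𝔾 Ω ρ → start ρ ≡ O →
              ∀ a b → γ 𝔾 ρ a b → γ 𝔾 π a b
  dominates .(_⊖_ 𝔾 κ κ) _ (κ , oκ , refl) start≡O _ _ = π-dominates κ oκ start≡O
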